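{- Let $E$ be a finite set and $\tau:2^{E}\to2^{E}$ an operator such that $(E,\tau)$ is a convex space, i.e. (C1) $X\subseteq\tau(X)$ for all $X\subseteq E$, and (Convexity) for all $X\subseteq Y\subseteq Z\subseteq E$ with $\tau(X)=\tau(Z)$ we have $\tau(Y)=\tau(X)=\tau(Z)$. Then $(E,\tau)$ is uniquely generated if and only if for all $X,Y\subseteq E$, $\tau(X)=\tau(Y)$ implies $\tau(X\cap Y)=\tau(X)=\tau(Y)$.
   Context: For $X\subseteq E$, a generator of $X$ is any set $B\subseteq E$ with $\tau(B)=\tau(X)$ (not required to be a subset of $X$); a basis of $X$ is a generator of $X$ that is inclusion-minimal among all generators of $X$. The space $(E,\tau)$ is uniquely generated if every $X\subseteq E$ has exactly one basis. -}

module Defs where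

open import Data.Nat using (ℕ)
open import Data.Fin.Subset using (Subset; _⊆_; _∩_)
open import Data.Product using (_×_; ∃-syntax)
open import Relation.Binary.PropositionalEquality using (_≡_)

Operator : ℕ → Set
Operator n = Subset n → Subset n

Extensive : ∀ {n} → Operator n → Set
Extensive τ = ∀ X → X ⊆ τ X

Convexity : ∀ {n} → Operator n → Set
Convexity τ = ∀ X Y Z → X ⊆ Y → Y ⊆ Z → τ X ≡ τ Z → (τ Y ≡ τ X) × (τ X ≡ τ Z)

IsConvexSpace : ∀ {n} → Operator n → Set
IsConvexSpace τ = Extensive τ × Convexity τ

-- B is a generator of X : τ B = τ X (B need not be a subset of X)
IsGenerator : ∀ {n} → Operator n → Subset n → Subset n → Set
IsGenerator τ X B = τ B ≡ τ X

IsBasis : ∀ {n} → Operator n → Subset n → Subset n → Set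
IsBasis τ X B = IsGenerator τ X B × (∀ C → IsGenerator τ X C → C ⊆ B → C ≡ B)

HasUniqueBasis : ∀ {n} → Operator n → Subset n → Set
HasUniqueBasis τ X = ∃[ B ] (IsBasis τ X B × (∀ B′ → IsBasis τ X B′ → B′ ≡ B))

UniquelyGenerated : ∀ {n} → Operator n → Set
UniquelyGenerated τ = ∀ X → HasUniqueBasis τ X

IntersectionProperty : ∀ {n} → Operator n → Set
IntersectionProperty τ = ∀ X Y → τ X ≡ τ Y → (τ (X ∩ Y) ≡ τ X) × (τ X ≡ τ Y)

-- Bases exist because E is finite: shrink X to an inclusion-minimal generator.
-- If generating sets are closed under intersection, two bases B, B′ of X meet
-- in a generator B ∩ B′ contained in both, so minimality forces B = B ∩ B′ = B′.
-- Conversely, if X has a unique basis B, then B lies inside every generator of X,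
-- in particular inside X and Y whenever τ X = τ Y; convexity applied to
-- B ⊆ X ∩ Y ⊆ X then yields τ (X ∩ Y) = τ X.
module Submission where

open import Defs
open import Data.Nat using (ℕ)
open import Data.Empty using (⊥-elim)
open import Data.Product using (_×_; _,_; proj₁; proj₂; ∃-syntax)
open import Data.Bool.Properties using () renaming (_≟_ to _≟ᵇ_)
open import Data.Vec.Properties using (≡-dec)
open import Data.Fin.Subset using (Subset; _⊆_; _⊂_; _⊄_; _∩_)
open import Data.Fin.Subset.Properties
  using (_∈?_; _⊂?_; ⊆-antisym; ⊆-refl; ⊆-trans; anySubset?; p∩q⊆p; p∩q⊆q; x∈p∩q⁺)
open import Data.Fin.Subset.Induction using (⊂-wellFounded)
open import Induction.WellFounded using (Acc; acc)
open import Relation.Nullary using (yes; no)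
open import Relation.Nullary.Decidable using (_×-dec_)
open import Relation.Unary using (Pred; Decidable)
open import Relation.Binary.PropositionalEquality using (_≡_; refl; sym; trans)

module _ {n : ℕ} where

  ⊆∧⊄⇒≡ : {p q : Subset n} → p ⊆ q → p ⊄ q → p ≡ q
  ⊆∧⊄⇒≡ {p} {q} p⊆q p⊄q = ⊆-antisym p⊆q q⊆p
    where
    q⊆p : q ⊆ p
    q⊆p {x} x∈q with x ∈? p
    ... | yes x∈p = x∈p
    ... | no  x∉p = ⊥-elim (p⊄q (p⊆q , x , x∈q , x∉p))

  ∃-minimal-⊆ : ∀ {ℓ} {P : Pred (Subset n) ℓ} → Decidable P → ∀ {G} → P G →
    ∃[ B ] (B ⊆ G × P B × (∀ C → P C → C ⊆ B → C ≡ B))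
  ∃-minimal-⊆ {P = P} P? {G} PG = go G (⊂-wellFounded G) PG
    where
    go : ∀ G → Acc _⊂_ G → P G → ∃[ B ] (B ⊆ G × P B × (∀ C → P C → C ⊆ B → C ≡ B))
    go G (acc rs) PG with anySubset? (λ C → (C ⊂? G) ×-dec P? C)
    ... | yes (C , C⊂G , PC) with go C (rs C⊂G) PC
    ...   | B , B⊆C , PB , minimal = B , ⊆-trans B⊆C (proj₁ C⊂G) , PB , minimal
    go G (acc rs) PG | no ∄C =
      G , ⊆-refl , PG , λ C PC C⊆G → ⊆∧⊄⇒≡ C⊆G (λ C⊂G → ∄C (C , C⊂G , PC))

module _ {n : ℕ} (τ : Operator n) where

  generator-⊇-basis : ∀ X {G} → IsGenerator τ X G → ∃[ B ] (B ⊆ G × IsBasis τ X B)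
  generator-⊇-basis X = ∃-minimal-⊆ (λ C → ≡-dec _≟ᵇ_ (τ C) (τ X))

  IsBasis-resp-τ : ∀ {X Y B} → τ X ≡ τ Y → IsBasis τ X B → IsBasis τ Y B
  IsBasis-resp-τ τX≡τY (generates , minimal) =
    trans generates τX≡τY , λ C τC≡τY → minimal C (trans τC≡τY (sym τX≡τY))

  uniqueBasis-⊆-generator : ∀ {X G} (u : HasUniqueBasis τ X) → IsGenerator τ X G → proj₁ u ⊆ G
  uniqueBasis-⊆-generator {X} (B , _ , unique) G-generates
    with generator-⊇-basis X G-generates
  ... | B′ , B′⊆G , B′-basis with unique B′ B′-basis
  ...   | refl = B′⊆G

  uniquelyGenerated⇒intersectionProperty :
    Convexity τ → UniquelyGenerated τ → IntersectionProperty τ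
  uniquelyGenerated⇒intersectionProperty convex ug X Y τX≡τY =
    trans (proj₁ (convex B (X ∩ Y) X B⊆X∩Y (p∩q⊆p X Y) B-generates)) B-generates , τX≡τY
    where
    B : Subset n
    B = proj₁ (ug X)
    B-generates : τ B ≡ τ X
    B-generates = proj₁ (proj₁ (proj₂ (ug X)))
    B⊆X∩Y : B ⊆ X ∩ Y
    B⊆X∩Y x∈B = x∈p∩q⁺ ( uniqueBasis-⊆-generator (ug X) refl x∈B
                       , uniqueBasis-⊆-generator (ug X) (sym τX≡τY) x∈B )

  intersectionProperty⇒basis-unique : IntersectionProperty τ →
    ∀ {X B B′} → IsBasis τ X B → IsBasis τ X B′ → B′ ≡ B
  intersectionProperty⇒basis-unique ip {X} {B} {B′} (generates , minimal) (generates′ , minimal′) =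
    trans (sym (minimal′ (B ∩ B′) B∩B′-generates (p∩q⊆q B B′)))
          (minimal (B ∩ B′) B∩B′-generates (p∩q⊆p B B′))
    where
    B∩B′-generates : τ (B ∩ B′) ≡ τ X
    B∩B′-generates = trans (proj₁ (ip B B′ (trans generates (sym generates′)))) generates

  intersectionProperty⇒uniquelyGenerated : IntersectionProperty τ → UniquelyGenerated τ
  intersectionProperty⇒uniquelyGenerated ip X with generator-⊇-basis X refl
  ... | B , _ , B-basis =
    B , B-basis , λ B′ B′-basis → intersectionProperty⇒basis-unique ip B-basis B′-basis

mainTheorem11 : (n : ℕ) (τ : Operator n) → IsConvexSpace τ →
    (UniquelyGenerated τ → IntersectionProperty τ) × (IntersectionProperty τ → UniquelyGenerated τ)
mainTheorem11 n τ (_ , convex) =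
  uniquelyGenerated⇒intersectionProperty τ convex , intersectionProperty⇒uniquelyGenerated τ
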